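{- Let $C\subset\mathbb{Z}_2^n$ be a $7$-cap of dimension $5$. Then $C$ is complete in dimension $5$ (no point of the $5$-flat $\mathrm{aff}(C)$ outside $C$ can be added to $C$ to form a cap; equivalently $\mathrm{qc}(C)=\mathrm{aff}(C)$), and $\mathrm{exc}(C)$ contains a point of multiplicity at least $2$.
   Context: $\mathbb{Z}_2^n$ is the $n$-dimensional vector space over $\mathbb{Z}_2$. A quad is a set of four distinct elements $a,b,c,d$ with $a+b+c+d=\vec 0$; a cap is a subset containing no quad; a $k$-cap is a cap with $k$ elements. For $S\subset\mathbb{Z}_2^n$, $\mathrm{exc}(S)=\{a+b+c: a,b,c\in S\text{ distinct}\}$ and $\mathrm{qc}(S)=S\cup\mathrm{exc}(S)$; the multiplicity of $p\in\mathrm{exc}(S)$ is the number of $3$-element subsets $\{x,y,z\}\subset S$ with $x+y+z=p$. Over $\mathbb{Z}_2$, $\mathrm{aff}(S)$ is the set of sums of an odd number of elements of $S$; the dimension of a cap $C$ is the dimension of the flat $\mathrm{aff}(C)$. -}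

module Defs where

open import Data.Bool using (Bool; false; _xor_)
open import Data.Nat using (ℕ; _^_)
open import Data.Nat.DivMod using (_%_)
open import Data.Vec using (Vec; zipWith; replicate)
open import Data.List using (List; length; foldr; _∷_)
open import Data.List.Membership.Propositional using (_∈_; _∉_)
open import Data.List.Relation.Unary.Unique.Propositional using (Unique)
open import Data.List.Relation.Binary.Sublist.Propositional using (_⊆_)
open import Data.Sum using (_⊎_)
open import Data.Product using (Σ; _×_; ∃; ∃-syntax)
open import Relation.Binary.PropositionalEquality using (_≡_; _≢_)
open import Relation.Nullary using (¬_)
open import Function.Bundles using (_⇔_)

-- ℤ₂ⁿ as bit vectors; addition is coordinatewise xor
Pt : ℕ → Set
Pt n = Vec Bool n

infixl 6 _⊕_
_⊕_ : ∀ {n} → Pt n → Pt n → Pt n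
_⊕_ = zipWith _xor_

𝟎 : ∀ {n} → Pt n
𝟎 = replicate _ false

Σpts : ∀ {n} → List (Pt n) → Pt n
Σpts = foldr _⊕_ 𝟎

Distinct4 : ∀ {n} → Pt n → Pt n → Pt n → Pt n → Set
Distinct4 a b c d =
  a ≢ b × a ≢ c × a ≢ d × b ≢ c × b ≢ d × c ≢ d

Distinct3 : ∀ {n} → Pt n → Pt n → Pt n → Set
Distinct3 a b c = a ≢ b × a ≢ c × b ≢ c

IsCap : ∀ {n} → List (Pt n) → Set
IsCap {n} S = ∀ (a b c d : Pt n) → a ∈ S → b ∈ S → c ∈ S → d ∈ S →
  Distinct4 a b c d → a ⊕ b ⊕ c ⊕ d ≢ 𝟎

IsKCap : ∀ {n} → ℕ → List (Pt n) → Set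
IsKCap k S = Unique S × length S ≡ k × IsCap S

-- aff(S): sums of an odd number of elements of S
-- (a sub-list of a duplicate-free list is a subset)
InAff : ∀ {n} → List (Pt n) → Pt n → Set
InAff S p = ∃[ T ] (T ⊆ S × length T % 2 ≡ 1 × Σpts T ≡ p)

InExc : ∀ {n} → List (Pt n) → Pt n → Set
InExc S p = ∃[ x ] ∃[ y ] ∃[ z ]
  (x ∈ S × y ∈ S × z ∈ S × Distinct3 x y z × x ⊕ y ⊕ z ≡ p)

InQC : ∀ {n} → List (Pt n) → Pt n → Set
InQC S p = p ∈ S ⊎ InExc S p

AffDim : ∀ {n} → List (Pt n) → ℕ → Set
AffDim {n} S d = ∃[ L ] (Unique L × length L ≡ 2 ^ d ×
  (∀ (p : Pt n) → p ∈ L ⇔ InAff S p))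

CompleteInAff : ∀ {n} → List (Pt n) → Set
CompleteInAff {n} C = ∀ (p : Pt n) → InAff C p → p ∉ C → ¬ IsCap (p ∷ C)

-- exc(S) has a point of multiplicity ≥ 2: two different 3-subsets
-- {x,y,z} ≠ {w,u,v} of S with the same sum (w is an element of the second
-- subset not in the first)
HasMult2 : ∀ {n} → List (Pt n) → Set
HasMult2 S = ∃[ x ] ∃[ y ] ∃[ z ] ∃[ w ] ∃[ u ] ∃[ v ]
  (x ∈ S × y ∈ S × z ∈ S × w ∈ S × u ∈ S × v ∈ S ×
   Distinct3 x y z × Distinct3 w u v ×
   w ≢ x × w ≢ y × w ≢ z ×
   x ⊕ y ⊕ z ≡ w ⊕ u ⊕ v)

module Submission where

open import Defs
open import Data.Nat using (ℕ)
open import Data.List using (List)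
open import Data.Product using (_×_)
open import Function.Bundles using (_⇔_)

open import Algebra.Bundles using (CommutativeSemigroup; CommutativeRing; CommutativeMonoid)
import Algebra.Properties.CommutativeSemigroup as CommutativeSemigroupProperties
open import Data.Bool using (Bool; true; false; not; _xor_; if_then_else_)
import Data.Bool.Properties as Bool
open import Data.Empty using (⊥-elim)
open import Data.Fin using (Fin)
open import Data.Fin.Properties using (pigeonhole; 2↔Bool; *↔×; <⇒≢)
open import Data.List using ([]; _∷_; _++_; length; lookup)
open import Data.List.Membership.Propositional using (_∈_)
open import Data.List.Relation.Binary.Sublist.Propositional using (_⊆_; []; _∷_; _∷ʳ_; from∈)
open import Data.List.Relation.Binary.Sublist.Propositional.Properties using (All-resp-⊆; Any-resp-⊆)
open import Data.List.Relation.Unary.AllPairs using ([]; _∷_)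
open import Data.List.Relation.Unary.All using ([]; _∷_)
open import Data.List.Relation.Unary.Any as Any using (here; there)
open import Data.List.Relation.Unary.Any.Properties using (lookup-result)
open import Data.List.Relation.Unary.Unique.Propositional using (Unique)
open import Data.Nat using (zero; suc; _∸_; _^_; _<_)
open import Data.Nat.DivMod using (_%_)
import Data.Nat.Properties as ℕ
open import Data.Product using (∃-syntax; ∃₂; _,_; proj₂)
open import Data.Product.Properties using (×-≡,≡→≡)
open import Data.Sum as Sum using (_⊎_; inj₁; inj₂)
open import Data.Vec using (Vec; []; _∷_)
open import Data.Vec.Properties as Vec using (zipWith-assoc; zipWith-comm; zipWith-identityˡ; zipWith-identityʳ; ∷-injective)
open import Function using (_∘_)
open import Function.Bundles using (Equivalence; Inverse; Injection; mk⇔)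
open import Function.Properties.Inverse using (↔⇒↣)
open import Relation.Binary.PropositionalEquality
open import Relation.Binary.PropositionalEquality.Algebra using (isMagma)
open import Relation.Nullary using (Dec; ¬?)
open import Relation.Nullary.Decidable using (map′; _×-dec_; _⊎-dec_; _→-dec_; toWitness)
open import Relation.Unary using (Decidable)

-- The sums of the 64 odd subsets of C all lie in aff(C), which has only 32
-- points, so two of them coincide and their symmetric difference is a
-- nonempty even subset of C with sum 0. Since the points of C are distinct
-- and C has no quad, this subset has six elements a,…,f, and
-- a + b + c = d + e + f is a point of exc(C) of multiplicity 2.
-- Adding this six-element relation to an odd subset with 5 or 7 elements
-- leaves one with 1 or 3 elements, so aff(C) = qc(C); finally a point
-- p = x + y + z of exc(C) outside C makes {p, x, y, z} a quad.

⊕-assoc : ∀ {n} (x y z : Pt n) → x ⊕ y ⊕ z ≡ x ⊕ (y ⊕ z)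
⊕-assoc = zipWith-assoc Bool.xor-assoc

⊕-comm : ∀ {n} (x y : Pt n) → x ⊕ y ≡ y ⊕ x
⊕-comm = zipWith-comm Bool.xor-comm

⊕-identityˡ : ∀ {n} (x : Pt n) → 𝟎 ⊕ x ≡ x
⊕-identityˡ = zipWith-identityˡ Bool.xor-identityˡ

⊕-identityʳ : ∀ {n} (x : Pt n) → x ⊕ 𝟎 ≡ x
⊕-identityʳ = zipWith-identityʳ Bool.xor-identityʳ

⊕-self : ∀ {n} (x : Pt n) → x ⊕ x ≡ 𝟎
⊕-self []      = refl
⊕-self (b ∷ x) = cong₂ _∷_ (Bool.xor-same b) (⊕-self x)

⊕-commutativeSemigroup : ℕ → CommutativeSemigroup _ _
⊕-commutativeSemigroup n = record
  { isCommutativeSemigroup = record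
    { isSemigroup = record { isMagma = isMagma (_⊕_ {n}) ; assoc = ⊕-assoc }
    ; comm        = ⊕-comm
    }
  }

module ⊕-Properties {n : ℕ} = CommutativeSemigroupProperties (⊕-commutativeSemigroup n)
open ⊕-Properties using (interchange; x∙yz≈y∙xz)

xor-interchange : ∀ a b c d → (a xor b) xor (c xor d) ≡ (a xor c) xor (b xor d)
xor-interchange = CommutativeSemigroupProperties.interchange
  (CommutativeMonoid.commutativeSemigroup
    (CommutativeRing.+-commutativeMonoid Bool.xor-∧-commutativeRing))

⊕-cancel : ∀ {n} {x y : Pt n} → x ⊕ y ≡ 𝟎 → x ≡ y
⊕-cancel {x = x} {y} x⊕y≡𝟎 = begin
  x             ≡⟨ ⊕-identityʳ x ⟨
  x ⊕ 𝟎         ≡⟨ cong (x ⊕_) (⊕-self y) ⟨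
  x ⊕ (y ⊕ y)   ≡⟨ ⊕-assoc x y y ⟨
  x ⊕ y ⊕ y     ≡⟨ cong (_⊕ y) x⊕y≡𝟎 ⟩
  𝟎 ⊕ y         ≡⟨ ⊕-identityˡ y ⟩
  y             ∎
  where open ≡-Reasoning

Σpts-++ : ∀ {n} (xs ys : List (Pt n)) → Σpts (xs ++ ys) ≡ Σpts xs ⊕ Σpts ys
Σpts-++ []       ys = sym (⊕-identityˡ (Σpts ys))
Σpts-++ (x ∷ xs) ys = trans (cong (x ⊕_) (Σpts-++ xs ys)) (sym (⊕-assoc x _ _))

Σpts-triple : ∀ {n} (a b c : Pt n) → Σpts (a ∷ b ∷ c ∷ []) ≡ a ⊕ b ⊕ c
Σpts-triple a b c = trans (cong (λ z → a ⊕ (b ⊕ z)) (⊕-identityʳ c)) (sym (⊕-assoc a b c))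

Σpts-quad : ∀ {n} (a b c d : Pt n) → Σpts (a ∷ b ∷ c ∷ d ∷ []) ≡ a ⊕ b ⊕ c ⊕ d
Σpts-quad a b c d =
  trans (Σpts-++ (a ∷ b ∷ c ∷ []) (d ∷ [])) (cong₂ _⊕_ (Σpts-triple a b c) (⊕-identityʳ d))

Unique-resp-⊆ : ∀ {A : Set} {xs ys : List A} → xs ⊆ ys → Unique ys → Unique xs
Unique-resp-⊆ []        _                = []
Unique-resp-⊆ (y ∷ʳ τ)  (_ ∷ ys-unique)  = Unique-resp-⊆ τ ys-unique
Unique-resp-⊆ (refl ∷ τ) (y∉ys ∷ ys-unique) = All-resp-⊆ τ y∉ys ∷ Unique-resp-⊆ τ ys-unique

Mask : {A : Set} → List A → Set
Mask xs = Vec Bool (length xs)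

select : {A : Set} (xs : List A) → Mask xs → List A
select []       []          = []
select (x ∷ xs) (true ∷ m)  = x ∷ select xs m
select (x ∷ xs) (false ∷ m) = select xs m

weight : ∀ {k} → Vec Bool k → ℕ
weight []          = 0
weight (true ∷ m)  = suc (weight m)
weight (false ∷ m) = weight m

parity : ∀ {k} → Vec Bool k → Bool
parity []      = false
parity (b ∷ m) = b xor parity m

select-⊆ : {A : Set} (xs : List A) (m : Mask xs) → select xs m ⊆ xs
select-⊆ []       []          = []
select-⊆ (x ∷ xs) (true ∷ m)  = refl ∷ select-⊆ xs m
select-⊆ (x ∷ xs) (false ∷ m) = x ∷ʳ select-⊆ xs m

length-select : {A : Set} (xs : List A) (m : Mask xs) → length (select xs m) ≡ weight m
length-select []       []          = refl
length-select (x ∷ xs) (true ∷ m)  = cong suc (length-select xs m)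
length-select (x ∷ xs) (false ∷ m) = length-select xs m

⊆⇒select : {A : Set} {ys xs : List A} → ys ⊆ xs → ∃[ m ] select xs m ≡ ys
⊆⇒select []       = [] , refl
⊆⇒select (x ∷ʳ τ) = let m , eq = ⊆⇒select τ in false ∷ m , eq
⊆⇒select (refl ∷ τ) = let m , eq = ⊆⇒select τ in true ∷ m , cong (_ ∷_) eq

Σpts-select-⊕ : ∀ {n} (C : List (Pt n)) (m m′ : Mask C) →
  Σpts (select C (m ⊕ m′)) ≡ Σpts (select C m) ⊕ Σpts (select C m′)
Σpts-select-⊕ []      []          []           = sym (⊕-identityʳ 𝟎)
Σpts-select-⊕ (x ∷ C) (true ∷ m)  (true ∷ m′)  = begin
  Σpts (select C (m ⊕ m′))                   ≡⟨ Σpts-select-⊕ C m m′ ⟩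
  a ⊕ b                                      ≡⟨ ⊕-identityˡ (a ⊕ b) ⟨
  𝟎 ⊕ (a ⊕ b)                                ≡⟨ cong (_⊕ (a ⊕ b)) (⊕-self x) ⟨
  x ⊕ x ⊕ (a ⊕ b)                            ≡⟨ interchange x x a b ⟩
  x ⊕ a ⊕ (x ⊕ b)                            ∎
  where
    open ≡-Reasoning
    a = Σpts (select C m)
    b = Σpts (select C m′)
Σpts-select-⊕ (x ∷ C) (true ∷ m)  (false ∷ m′) =
  trans (cong (x ⊕_) (Σpts-select-⊕ C m m′)) (sym (⊕-assoc x _ _))
Σpts-select-⊕ (x ∷ C) (false ∷ m) (true ∷ m′)  =
  trans (cong (x ⊕_) (Σpts-select-⊕ C m m′)) (x∙yz≈y∙xz x _ _)
Σpts-select-⊕ (x ∷ C) (false ∷ m) (false ∷ m′) = Σpts-select-⊕ C m m′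

parity-⊕ : ∀ {k} (m m′ : Vec Bool k) → parity (m ⊕ m′) ≡ parity m xor parity m′
parity-⊕ []      []        = refl
parity-⊕ (a ∷ m) (b ∷ m′) =
  trans (cong ((a xor b) xor_) (parity-⊕ m m′)) (xor-interchange a b (parity m) (parity m′))

suc-%2 : ∀ w → suc w % 2 ≡ 1 ∸ w % 2
suc-%2 0             = refl
suc-%2 1             = refl
suc-%2 (suc (suc w)) = suc-%2 w

weight-%2 : ∀ {k} (m : Vec Bool k) → weight m % 2 ≡ (if parity m then 1 else 0)
weight-%2 []          = refl
weight-%2 (false ∷ m) = weight-%2 m
weight-%2 (true ∷ m)  = begin
  suc (weight m) % 2                     ≡⟨ suc-%2 (weight m) ⟩
  1 ∸ weight m % 2                       ≡⟨ cong (1 ∸_) (weight-%2 m) ⟩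
  1 ∸ (if parity m then 1 else 0)        ≡⟨ 1∸bit (parity m) ⟩
  (if not (parity m) then 1 else 0)      ∎
  where
    open ≡-Reasoning
    1∸bit : ∀ b → 1 ∸ (if b then 1 else 0) ≡ (if not b then 1 else 0)
    1∸bit true  = refl
    1∸bit false = refl

odd-weight⇔parity : ∀ {k} (m : Vec Bool k) → weight m % 2 ≡ 1 ⇔ parity m ≡ true
odd-weight⇔parity m with parity m | weight-%2 m
... | true  | w%2≡1 = mk⇔ (λ _ → refl) (λ _ → w%2≡1)
... | false | w%2≡0 = mk⇔ (λ w%2≡1 → ⊥-elim (ℕ.0≢1+n (trans (sym w%2≡0) w%2≡1))) λ ()

OddMaskSum : ∀ {n} → List (Pt n) → Pt n → Set
OddMaskSum C p = ∃[ m ] (parity m ≡ true × Σpts (select C m) ≡ p)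

InAff⇔OddMaskSum : ∀ {n} {C : List (Pt n)} {p} → InAff C p ⇔ OddMaskSum C p
InAff⇔OddMaskSum {C = C} = mk⇔ to from
  where
  to : ∀ {p} → InAff C p → OddMaskSum C p
  to (T , T⊆C , |T|-odd , ΣT≡p) =
    let m , select≡T = ⊆⇒select T⊆C
        |m|≡|T| = trans (sym (length-select C m)) (cong length select≡T)
    in m , Equivalence.to (odd-weight⇔parity m) (trans (cong (_% 2) |m|≡|T|) |T|-odd)
         , trans (cong Σpts select≡T) ΣT≡p
  from : ∀ {p} → OddMaskSum C p → InAff C p
  from (m , m-odd , Σ≡p) =
    select C m , select-⊆ C m ,
    trans (cong (_% 2) (length-select C m)) (Equivalence.from (odd-weight⇔parity m) m-odd) ,
    Σ≡p

∈⇒InAff : ∀ {n} {C : List (Pt n)} {x} → x ∈ C → InAff C x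
∈⇒InAff {x = x} x∈C = x ∷ [] , from∈ x∈C , refl , ⊕-identityʳ x

InAff-⊕₃ : ∀ {n} {C : List (Pt n)} {p q r} →
  InAff C p → InAff C q → InAff C r → InAff C (p ⊕ q ⊕ r)
InAff-⊕₃ {C = C} p∈aff q∈aff r∈aff =
  let mp , mp-odd , Σmp≡p = Equivalence.to InAff⇔OddMaskSum p∈aff
      mq , mq-odd , Σmq≡q = Equivalence.to InAff⇔OddMaskSum q∈aff
      mr , mr-odd , Σmr≡r = Equivalence.to InAff⇔OddMaskSum r∈aff
      odd = trans (parity-⊕ (mp ⊕ mq) mr)
              (cong₂ _xor_ (trans (parity-⊕ mp mq) (cong₂ _xor_ mp-odd mq-odd)) mr-odd)
      sum = trans (Σpts-select-⊕ C (mp ⊕ mq) mr)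
              (cong₂ _⊕_ (trans (Σpts-select-⊕ C mp mq) (cong₂ _⊕_ Σmp≡p Σmq≡q)) Σmr≡r)
  in Equivalence.from InAff⇔OddMaskSum (mp ⊕ mq ⊕ mr , odd , sum)

InQC⇒InAff : ∀ {n} {C : List (Pt n)} {p} → InQC C p → InAff C p
InQC⇒InAff (inj₁ p∈C) = ∈⇒InAff p∈C
InQC⇒InAff (inj₂ (x , y , z , x∈C , y∈C , z∈C , _ , x⊕y⊕z≡p)) =
  subst (InAff _) x⊕y⊕z≡p (InAff-⊕₃ (∈⇒InAff x∈C) (∈⇒InAff y∈C) (∈⇒InAff z∈C))

aff⊆qc⇒complete : ∀ {n} {C : List (Pt n)} → (∀ p → InAff C p → InQC C p) → CompleteInAff C
aff⊆qc⇒complete {C = C} aff⊆qc p p∈aff p∉C p∷C-cap with aff⊆qc p p∈aff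
... | inj₁ p∈C = p∉C p∈C
... | inj₂ (x , y , z , x∈C , y∈C , z∈C , (x≢y , x≢z , y≢z) , x⊕y⊕z≡p) =
  p∷C-cap p x y z (here refl) (there x∈C) (there y∈C) (there z∈C)
    (p≢ x∈C , p≢ y∈C , p≢ z∈C , x≢y , x≢z , y≢z) quad-sum
  where
    p≢ : ∀ {w} → w ∈ C → p ≢ w
    p≢ w∈C refl = p∉C w∈C
    open ≡-Reasoning
    quad-sum : p ⊕ x ⊕ y ⊕ z ≡ 𝟎
    quad-sum = begin
      p ⊕ x ⊕ y ⊕ z       ≡⟨ cong (_⊕ z) (⊕-assoc p x y) ⟩
      p ⊕ (x ⊕ y) ⊕ z     ≡⟨ ⊕-assoc p (x ⊕ y) z ⟩
      p ⊕ (x ⊕ y ⊕ z)     ≡⟨ cong (p ⊕_) x⊕y⊕z≡p ⟩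
      p ⊕ p               ≡⟨ ⊕-self p ⟩
      𝟎                   ∎

small-subset⇒InQC : ∀ {n} {T C : List (Pt n)} → T ⊆ C → Unique T →
  length T ≡ 1 ⊎ length T ≡ 3 → InQC C (Σpts T)
small-subset⇒InQC {T = a ∷ []} T⊆C _ _ =
  inj₁ (subst (_∈ _) (sym (⊕-identityʳ a)) (Any-resp-⊆ T⊆C (here refl)))
small-subset⇒InQC {T = a ∷ b ∷ c ∷ []} T⊆C ((a≢b ∷ a≢c ∷ []) ∷ (b≢c ∷ []) ∷ [] ∷ []) _ =
  inj₂ (a , b , c , Any-resp-⊆ T⊆C (here refl) , Any-resp-⊆ T⊆C (there (here refl)) ,
        Any-resp-⊆ T⊆C (there (there (here refl))) , (a≢b , a≢c , b≢c) , sym (Σpts-triple a b c))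
small-subset⇒InQC {T = []}                  _ _ (inj₁ ())
small-subset⇒InQC {T = []}                  _ _ (inj₂ ())
small-subset⇒InQC {T = _ ∷ _ ∷ []}          _ _ (inj₁ ())
small-subset⇒InQC {T = _ ∷ _ ∷ []}          _ _ (inj₂ ())
small-subset⇒InQC {T = _ ∷ _ ∷ _ ∷ _ ∷ _}  _ _ (inj₁ ())
small-subset⇒InQC {T = _ ∷ _ ∷ _ ∷ _ ∷ _}  _ _ (inj₂ ())

Unique⇒zero-sum-pair-impossible : ∀ {n} {T : List (Pt n)} → Unique T → length T ≡ 2 → Σpts T ≢ 𝟎
Unique⇒zero-sum-pair-impossible {T = a ∷ b ∷ []} ((a≢b ∷ []) ∷ _) _ a⊕b≡𝟎 =
  a≢b (⊕-cancel (trans (cong (a ⊕_) (sym (⊕-identityʳ b))) a⊕b≡𝟎))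
Unique⇒zero-sum-pair-impossible {T = []}            _ ()
Unique⇒zero-sum-pair-impossible {T = _ ∷ []}        _ ()
Unique⇒zero-sum-pair-impossible {T = _ ∷ _ ∷ _ ∷ _} _ ()

cap⇒zero-sum-quad-impossible : ∀ {n} {T C : List (Pt n)} → IsCap C → T ⊆ C → Unique T →
  length T ≡ 4 → Σpts T ≢ 𝟎
cap⇒zero-sum-quad-impossible {T = a ∷ b ∷ c ∷ d ∷ []} C-cap T⊆C
  ((a≢b ∷ a≢c ∷ a≢d ∷ []) ∷ (b≢c ∷ b≢d ∷ []) ∷ (c≢d ∷ []) ∷ [] ∷ []) _ ΣT≡𝟎 =
  C-cap a b c d (Any-resp-⊆ T⊆C (here refl)) (Any-resp-⊆ T⊆C (there (here refl)))
    (Any-resp-⊆ T⊆C (there (there (here refl)))) (Any-resp-⊆ T⊆C (there (there (there (here refl)))))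
    (a≢b , a≢c , a≢d , b≢c , b≢d , c≢d) (trans (sym (Σpts-quad a b c d)) ΣT≡𝟎)
cap⇒zero-sum-quad-impossible {T = []}                    _ _ _ ()
cap⇒zero-sum-quad-impossible {T = _ ∷ []}                _ _ _ ()
cap⇒zero-sum-quad-impossible {T = _ ∷ _ ∷ []}            _ _ _ ()
cap⇒zero-sum-quad-impossible {T = _ ∷ _ ∷ _ ∷ []}        _ _ _ ()
cap⇒zero-sum-quad-impossible {T = _ ∷ _ ∷ _ ∷ _ ∷ _ ∷ _} _ _ _ ()

zero-sum-six⇒HasMult2 : ∀ {n} {T C : List (Pt n)} → T ⊆ C → Unique T →
  length T ≡ 6 → Σpts T ≡ 𝟎 → HasMult2 C
zero-sum-six⇒HasMult2 {T = a ∷ b ∷ c ∷ d ∷ e ∷ f ∷ []} T⊆C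
  ((a≢b ∷ a≢c ∷ a≢d ∷ _ ∷ _ ∷ []) ∷ (b≢c ∷ b≢d ∷ _ ∷ _ ∷ []) ∷ (c≢d ∷ _ ∷ _ ∷ []) ∷
   (d≢e ∷ d≢f ∷ []) ∷ (e≢f ∷ []) ∷ [] ∷ []) _ ΣT≡𝟎 =
  a , b , c , d , e , f , mem (here refl) , mem (there (here refl)) ,
  mem (there (there (here refl))) , mem (there (there (there (here refl)))) ,
  mem (there (there (there (there (here refl))))) ,
  mem (there (there (there (there (there (here refl)))))) ,
  (a≢b , a≢c , b≢c) , (d≢e , d≢f , e≢f) , a≢d ∘ sym , b≢d ∘ sym , c≢d ∘ sym ,
  ⊕-cancel (begin
    a ⊕ b ⊕ c ⊕ (d ⊕ e ⊕ f)                               ≡⟨ cong₂ _⊕_ (Σpts-triple a b c) (Σpts-triple d e f) ⟨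
    Σpts (a ∷ b ∷ c ∷ []) ⊕ Σpts (d ∷ e ∷ f ∷ [])         ≡⟨ Σpts-++ (a ∷ b ∷ c ∷ []) (d ∷ e ∷ f ∷ []) ⟨
    Σpts (a ∷ b ∷ c ∷ d ∷ e ∷ f ∷ [])                     ≡⟨ ΣT≡𝟎 ⟩
    𝟎                                                     ∎)
  where
    open ≡-Reasoning
    mem : ∀ {x} → x ∈ a ∷ b ∷ c ∷ d ∷ e ∷ f ∷ [] → x ∈ _
    mem = Any-resp-⊆ T⊆C
zero-sum-six⇒HasMult2 {T = []}                                _ _ () _
zero-sum-six⇒HasMult2 {T = _ ∷ []}                            _ _ () _
zero-sum-six⇒HasMult2 {T = _ ∷ _ ∷ []}                        _ _ () _
zero-sum-six⇒HasMult2 {T = _ ∷ _ ∷ _ ∷ []}                    _ _ () _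
zero-sum-six⇒HasMult2 {T = _ ∷ _ ∷ _ ∷ _ ∷ []}                _ _ () _
zero-sum-six⇒HasMult2 {T = _ ∷ _ ∷ _ ∷ _ ∷ _ ∷ []}            _ _ () _
zero-sum-six⇒HasMult2 {T = _ ∷ _ ∷ _ ∷ _ ∷ _ ∷ _ ∷ _ ∷ _}     _ _ () _

pigeonhole-∈ : ∀ {A : Set} {N} {L : List A} → length L < N → (f : Fin N → A) → (∀ i → f i ∈ L) →
  ∃₂ λ i j → i ≢ j × f i ≡ f j
pigeonhole-∈ {L = L} |L|<N f f∈L
  with i , j , i<j , same-index ← pigeonhole |L|<N (Any.index ∘ f∈L) =
  i , j , <⇒≢ i<j ,
  trans (lookup-result (f∈L i)) (trans (cong (lookup L) same-index) (sym (lookup-result (f∈L j))))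

bits : ∀ k → Fin (2 ^ k) → Vec Bool k
bits zero    _ = []
bits (suc k) i = let b , j = Inverse.to (*↔× {2} {2 ^ k}) i in Inverse.to 2↔Bool b ∷ bits k j

bits-injective : ∀ k {i j} → bits k i ≡ bits k j → i ≡ j
bits-injective zero    {Fin.zero} {Fin.zero} _ = refl
bits-injective (suc k) eq with ∷-injective eq
... | head≡ , tail≡ = Injection.injective (↔⇒↣ (*↔× {2} {2 ^ k}))
  (×-≡,≡→≡ (Injection.injective (↔⇒↣ 2↔Bool) head≡ , bits-injective k tail≡))

odd-vector : ∀ k → Fin (2 ^ k) → Vec Bool (suc k)
odd-vector k i = not (parity (bits k i)) ∷ bits k i

odd-vector-odd : ∀ k i → parity (odd-vector k i) ≡ true
odd-vector-odd k i = Bool.xor-inverseˡ (parity (bits k i))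

odd-vector-injective : ∀ k {i j} → odd-vector k i ≡ odd-vector k j → i ≡ j
odd-vector-injective k = bits-injective k ∘ proj₂ ∘ ∷-injective

even-zero-sum-mask : ∀ {n} {x : Pt n} {xs} (L : List (Pt n)) → length L < 2 ^ length xs →
  (∀ {p} → InAff (x ∷ xs) p → p ∈ L) →
  ∃[ D ] (D ≢ 𝟎 × parity D ≡ false × Σpts (select (x ∷ xs) D) ≡ 𝟎)
even-zero-sum-mask {x = x} {xs} L |L|<2^k aff⊆L =
  let i , j , i≢j , Σi≡Σj = pigeonhole-∈ |L|<2^k (Σpts ∘ select C ∘ v) odd-sum∈L
  in v i ⊕ v j ,
     i≢j ∘ odd-vector-injective k ∘ ⊕-cancel ,
     trans (parity-⊕ (v i) (v j)) (cong₂ _xor_ (odd-vector-odd k i) (odd-vector-odd k j)) ,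
     trans (Σpts-select-⊕ C (v i) (v j)) (trans (cong (_⊕ Σpts (select C (v j))) Σi≡Σj) (⊕-self _))
  where
    C = x ∷ xs
    k = length xs
    v = odd-vector k
    odd-sum∈L : ∀ i → Σpts (select C (v i)) ∈ L
    odd-sum∈L i = aff⊆L (Equivalence.from InAff⇔OddMaskSum (v i , odd-vector-odd k i , refl))

∀-Vec-Bool? : ∀ {k} {P : Vec Bool k → Set} → Decidable P → Dec (∀ v → P v)
∀-Vec-Bool? {zero}  P? = map′ (λ p → λ { [] → p }) (λ ∀P → ∀P []) (P? [])
∀-Vec-Bool? {suc k} P? =
  map′ (λ (∀P₁ , ∀P₀) → λ { (true ∷ v) → ∀P₁ v ; (false ∷ v) → ∀P₀ v })
       (λ ∀P → (λ v → ∀P (true ∷ v)) , (λ v → ∀P (false ∷ v)))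
       (∀-Vec-Bool? (P? ∘ (true ∷_)) ×-dec ∀-Vec-Bool? (P? ∘ (false ∷_)))

-- Two facts about vectors of length 7, checked exhaustively. They are stated
-- for any k ≡ 7 so that they apply to masks of length (length C) without a cast.
even-nonzero-weight : ∀ {k} → k ≡ 7 → (D : Vec Bool k) → D ≢ 𝟎 → parity D ≡ false →
  weight D ≡ 2 ⊎ weight D ≡ 4 ⊎ weight D ≡ 6
even-nonzero-weight refl = toWitness {a? = ∀-Vec-Bool? λ D →
  ¬? (Vec.≡-dec Bool._≟_ D 𝟎) →-dec ((parity D Bool.≟ false) →-dec
  ((weight D ℕ.≟ 2) ⊎-dec ((weight D ℕ.≟ 4) ⊎-dec (weight D ℕ.≟ 6))))} _

Weight1or3 : ∀ {k} → Vec Bool k → Set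
Weight1or3 m = weight m ≡ 1 ⊎ weight m ≡ 3

reduce-odd-vector : ∀ {k} → k ≡ 7 → (D m : Vec Bool k) → weight D ≡ 6 → parity m ≡ true →
  Weight1or3 m ⊎ Weight1or3 (m ⊕ D)
reduce-odd-vector refl = toWitness {a? = ∀-Vec-Bool? λ D → ∀-Vec-Bool? λ m →
  (weight D ℕ.≟ 6) →-dec ((parity m Bool.≟ true) →-dec (weight1or3? m ⊎-dec weight1or3? (m ⊕ D)))} _
  where
    weight1or3? : (m : Vec Bool 7) → Dec (Weight1or3 m)
    weight1or3? m = (weight m ℕ.≟ 1) ⊎-dec (weight m ℕ.≟ 3)

select-Unique : ∀ {A : Set} {xs : List A} → Unique xs → (m : Mask xs) → Unique (select xs m)
select-Unique {xs = xs} xs-unique m = Unique-resp-⊆ (select-⊆ xs m) xs-unique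

weight1or3⇒InQC : ∀ {n} {C : List (Pt n)} → Unique C → (m : Mask C) → Weight1or3 m →
  InQC C (Σpts (select C m))
weight1or3⇒InQC {C = C} C-unique m |m|≡1∨3 = small-subset⇒InQC (select-⊆ C m) (select-Unique C-unique m)
  (Sum.map (trans (length-select C m)) (trans (length-select C m)) |m|≡1∨3)

zero-sum-weight-six : ∀ {n} {C : List (Pt n)} → length C ≡ 7 → Unique C → IsCap C →
  (D : Mask C) → D ≢ 𝟎 → parity D ≡ false → Σpts (select C D) ≡ 𝟎 → weight D ≡ 6
zero-sum-weight-six {C = C} |C|≡7 C-unique C-cap D D≢𝟎 D-even ΣD≡𝟎
  with even-nonzero-weight |C|≡7 D D≢𝟎 D-even
... | inj₁ |D|≡2 = ⊥-elim (Unique⇒zero-sum-pair-impossible (select-Unique C-unique D)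
                            (trans (length-select C D) |D|≡2) ΣD≡𝟎)
... | inj₂ (inj₁ |D|≡4) = ⊥-elim (cap⇒zero-sum-quad-impossible C-cap (select-⊆ C D)
                                   (select-Unique C-unique D) (trans (length-select C D) |D|≡4) ΣD≡𝟎)
... | inj₂ (inj₂ |D|≡6) = |D|≡6

six-point-relation : ∀ {n} {C : List (Pt n)} → length C ≡ 7 → Unique C → IsCap C → AffDim C 5 →
  ∃[ D ] (weight D ≡ 6 × Σpts (select C D) ≡ 𝟎)
six-point-relation {C = []} ()
six-point-relation {C = x ∷ xs} |C|≡7 C-unique C-cap (L , _ , |L|≡32 , L≡aff) =
  let D , D≢𝟎 , D-even , ΣD≡𝟎 = even-zero-sum-mask L |L|<2^|xs| (Equivalence.from (L≡aff _))
  in D , zero-sum-weight-six |C|≡7 C-unique C-cap D D≢𝟎 D-even ΣD≡𝟎 , ΣD≡𝟎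
  where
    |L|<2^|xs| : length L < 2 ^ length xs
    |L|<2^|xs| rewrite |L|≡32 | ℕ.suc-injective |C|≡7 = ℕ.<ᵇ⇒< 32 64 _

aff⊆qc : ∀ {n} {C : List (Pt n)} → length C ≡ 7 → Unique C → (D : Mask C) →
  weight D ≡ 6 → Σpts (select C D) ≡ 𝟎 → ∀ p → InAff C p → InQC C p
aff⊆qc {C = C} |C|≡7 C-unique D |D|≡6 ΣD≡𝟎 p p∈aff
  with m , m-odd , Σm≡p ← Equivalence.to InAff⇔OddMaskSum p∈aff
  with reduce-odd-vector |C|≡7 D m |D|≡6 m-odd
... | inj₁ |m|≡1∨3 = subst (InQC C) Σm≡p (weight1or3⇒InQC C-unique m |m|≡1∨3)
... | inj₂ |m⊕D|≡1∨3 = subst (InQC C) Σ[m⊕D]≡p (weight1or3⇒InQC C-unique (m ⊕ D) |m⊕D|≡1∨3)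
  where
    Σ[m⊕D]≡p : Σpts (select C (m ⊕ D)) ≡ p
    Σ[m⊕D]≡p = trans (Σpts-select-⊕ C m D)
      (trans (cong (Σpts (select C m) ⊕_) ΣD≡𝟎) (trans (⊕-identityʳ _) Σm≡p))

theorem5p22 : ∀ (n : ℕ) (C : List (Pt n)) → IsKCap 7 C → AffDim C 5 →
    (CompleteInAff C × (∀ (p : Pt n) → InQC C p ⇔ InAff C p)) × HasMult2 C
theorem5p22 n C (C-unique , |C|≡7 , C-cap) dim5
  with D , |D|≡6 , ΣD≡𝟎 ← six-point-relation |C|≡7 C-unique C-cap dim5 =
  let aff⊆qc′ = aff⊆qc |C|≡7 C-unique D |D|≡6 ΣD≡𝟎 in
  (aff⊆qc⇒complete aff⊆qc′ , λ p → mk⇔ InQC⇒InAff (aff⊆qc′ p)) ,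
  zero-sum-six⇒HasMult2 (select-⊆ C D) (select-Unique C-unique D)
    (trans (length-select C D) |D|≡6) ΣD≡𝟎
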